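{- For all integers $s,t\ge 2$ and every $q\in Q_{s,t}$, the set $Q_{s,t}\setminus\{q\}$ is compatible.
   Context: For integers $s,t\ge2$, let $\mathcal{L}_{s,t}=\{a_1,\dots,a_s,b_1,\dots,b_t\}$ and $Q_{s,t}=\{a_1b_1|a_sb_t\}\cup\{a_ia_{i+1}|b_jb_{j+1} : 1\le i\le s-1,\ 1\le j\le t-1\}$. A quartet is a binary unrooted phylogenetic tree with four leaves; $ab|cd$ denotes the quartet on $\{a,b,c,d\}$ in which the path between $a$ and $b$ is disjoint from the path between $c$ and $d$. An unrooted phylogenetic tree is a tree with no degree-two vertex whose leaves are bijectively labeled. A tree $T$ displays a tree $T'$ if $T'$ is obtained from the restriction $T|\mathcal{L}(T')$ (minimal subtree spanning the leaves labeled by $\mathcal{L}(T')$, with degree-two vertices suppressed) by contracting edges. A set of quartets is compatible if some unrooted phylogenetic tree displays all of them. -}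

module Defs where

open import Data.Nat using (ℕ; zero; suc; _∸_)
open import Data.Fin using (Fin; toℕ)
open import Data.Sum using (_⊎_; inj₁; inj₂)
open import Data.Product using (Σ; ∃; _×_; _,_)
open import Data.Maybe using (Maybe; just)
open import Data.List using (List; head; last)
open import Data.List.Relation.Unary.Linked using (Linked)
open import Data.List.Relation.Unary.Unique.Propositional using (Unique)
open import Data.List.Membership.Propositional using (_∈_)
open import Data.Empty using (⊥)
open import Relation.Nullary using (¬_)
open import Relation.Binary.PropositionalEquality using (_≡_; _≢_)
open import Function.Definitions using (Injective)

record Graph (n : ℕ) : Set₁ where
  field
    Adj     : Fin n → Fin n → Set
    symm    : ∀ {u v} → Adj u v → Adj v u
    irrefl  : ∀ {u} → ¬ Adj u u

IsPath : ∀ {n} → Graph n → Fin n → Fin n → List (Fin n) → Set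
IsPath G u v xs =
  Linked (Graph.Adj G) xs × Unique xs × head xs ≡ just u × last xs ≡ just v

IsTree : ∀ {n} → Graph n → Set
IsTree G =
  (∀ u v → ∃ λ xs → IsPath G u v xs) ×
  (∀ u v xs ys → IsPath G u v xs → IsPath G u v ys → xs ≡ ys)

IsLeaf : ∀ {n} → Graph n → Fin n → Set
IsLeaf G v = ∃ λ x → Graph.Adj G v x × (∀ y → Graph.Adj G v y → y ≡ x)

DegreeTwo : ∀ {n} → Graph n → Fin n → Set
DegreeTwo G v = ∃ λ x → ∃ λ y → x ≢ y × Graph.Adj G v x × Graph.Adj G v y ×
  (∀ z → Graph.Adj G v z → z ≡ x ⊎ z ≡ y)

record PhyloTree (X : Set) : Set₁ where
  field
    n          : ℕ
    graph      : Graph n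
    isTree     : IsTree graph
    noDeg2     : ∀ v → ¬ DegreeTwo graph v
    label      : X → Fin n
    labelInj   : Injective _≡_ _≡_ label
    labelLeaf  : ∀ x → IsLeaf graph (label x)
    leafLabel  : ∀ v → IsLeaf graph v → ∃ λ x → label x ≡ v

record Quartet (X : Set) : Set where
  constructor _∙_∣_∙_
  field
    a b c d : X

-- Same quartet tree: {{a,b},{c,d}} equal as unordered pair of unordered pairs
SamePair : ∀ {X : Set} → X → X → X → X → Set
SamePair x y x' y' = (x ≡ x' × y ≡ y') ⊎ (x ≡ y' × y ≡ x')

SameQuartet : ∀ {X : Set} → Quartet X → Quartet X → Set
SameQuartet (a ∙ b ∣ c ∙ d) (a' ∙ b' ∣ c' ∙ d') =
  (SamePair a b a' b' × SamePair c d c' d') ⊎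
  (SamePair a b c' d' × SamePair c d a' b')

Disjoint : ∀ {n} → List (Fin n) → List (Fin n) → Set
Disjoint xs ys = ∀ z → z ∈ xs → z ∈ ys → ⊥

Displays : ∀ {X} → PhyloTree X → Quartet X → Set
Displays T (a ∙ b ∣ c ∙ d) =
  ∀ xs ys → IsPath G (label a) (label b) xs → IsPath G (label c) (label d) ys →
  Disjoint xs ys
  where open PhyloTree T
        G = graph

Compatible : ∀ {X} → (Quartet X → Set) → Set₁
Compatible {X} P = Σ (PhyloTree X) λ T → ∀ q → P q → Displays T q

-- The label set L_{s,t} and the quartet set Q_{s,t}
-- (indices are 0-based: a_i is aL i with toℕ i = i-1)

L : ℕ → ℕ → Set
L s t = Fin s ⊎ Fin t

aL : ∀ {s t} → Fin s → L s t
aL = inj₁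

bL : ∀ {s t} → Fin t → L s t
bL = inj₂

data Q (s t : ℕ) : Quartet (L s t) → Set where
  ends : (i₁ iₛ : Fin s) (j₁ jₜ : Fin t) →
         toℕ i₁ ≡ 0 → toℕ iₛ ≡ s ∸ 1 → toℕ j₁ ≡ 0 → toℕ jₜ ≡ t ∸ 1 →
         Q s t (aL i₁ ∙ bL j₁ ∣ aL iₛ ∙ bL jₜ)
  mid  : (i i' : Fin s) (j j' : Fin t) →
         toℕ i' ≡ suc (toℕ i) → toℕ j' ≡ suc (toℕ j) →
         Q s t (aL i ∙ aL i' ∣ bL j ∙ bL j')

{-# OPTIONS --safe #-}
-- Removing a₁b₁|a_sb_t: hang all a's from one vertex and all b's from an adjacent one; every
-- a_ia_{i+1}|b_jb_{j+1} is then separated by the edge between them.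
-- Removing a_ka_{k+1}|b_lb_{l+1}: take an edge U–W, hang caterpillars on a₁ … a_k and on b₁ … b_l
-- from U and caterpillars on the remaining a's and on the remaining b's from W. The edge separates
-- a₁b₁ from a_sb_t, and every other a_ia_{i+1}|b_jb_{j+1} has one of its pairs inside a single
-- caterpillar that misses the other pair.
-- Trees are built from parent pointers, and ab|cd is displayed as soon as some vertex has a and b
-- below it but neither c nor d: a path between two vertices of a subtree stays inside it, and a path
-- between two vertices outside it stays outside.
module Submission where

open import Defs
open import Data.Nat using (ℕ; zero; suc; _+_; _∸_; _≤_; _<_; s≤s; z≤n; z<s)
open import Data.Nat.Properties
  using (≤-refl; ≤-trans; ≤-reflexive; <-irrefl; <⇒≤; <-≤-trans; ≤-<-trans; <-cmp; m<n⇒m<1+n; m<m+n; +-suc; m+[n∸m]≡n)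
open import Data.Fin using (Fin; zero; suc; toℕ; _≟_; splitAt; join; _↑ˡ_; _↑ʳ_)
open import Data.Fin.Properties using (toℕ-injective; toℕ<n; +↔⊎; join-splitAt; splitAt-↑ˡ; splitAt-↑ʳ; splitAt-<; splitAt-≥)
open import Data.Sum using (_⊎_; inj₁; inj₂; [_,_]′)
open import Data.Sum.Function.Propositional using (_⊎-↔_)
open import Data.Product using (Σ; ∃; _×_; _,_)
open import Data.Maybe using (Maybe; just; nothing)
import Data.Maybe as Maybe
open import Data.Maybe.Properties using (just-injective)
import Data.Maybe.Relation.Unary.All as MaybeAll
open import Data.List using (List; []; _∷_; head; last; _++_)
open import Data.List.Relation.Unary.Linked using (Linked; []; [-]; _∷_)
open import Data.List.Relation.Unary.Unique.Propositional using (Unique)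
open import Data.List.Relation.Unary.AllPairs using ([]; _∷_)
open import Data.List.Relation.Unary.All as All using (All; []; _∷_)
open import Data.List.Relation.Unary.All.Properties using (¬Any⇒All¬; last⁺)
open import Data.List.Relation.Unary.Any using (here; there; any?)
open import Data.List.Membership.Propositional using (_∈_)
open import Data.Unit using (⊤; tt)
open import Data.Empty using (⊥; ⊥-elim)
open import Function.Bundles using (_↔_; Inverse)
open import Function.Properties.Inverse using (↔-refl; ↔-sym; ↔-trans)
open import Relation.Nullary using (¬_; yes; no)
open import Relation.Binary.Definitions using (tri<; tri≈; tri>)
open import Relation.Binary.PropositionalEquality
  using (_≡_; _≢_; refl; sym; trans; cong; subst; subst₂)

All-last : ∀ {A : Set} {P : A → Set} {xs : List A} {x : A} → All P xs → last xs ≡ just x → P x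
All-last {P = P} ps eq with subst (MaybeAll.All P) eq (last⁺ ps)
... | MaybeAll.just px = px

three-distinct-in-pair : ∀ {A : Set} {x y a b c : A} → a ≢ b → a ≢ c → b ≢ c →
                         (a ≡ x ⊎ a ≡ y) → (b ≡ x ⊎ b ≡ y) → (c ≡ x ⊎ c ≡ y) → ⊥
three-distinct-in-pair a≢b _   _   (inj₁ refl) (inj₁ refl) _           = a≢b refl
three-distinct-in-pair a≢b _   _   (inj₂ refl) (inj₂ refl) _           = a≢b refl
three-distinct-in-pair _   a≢c _   (inj₁ refl) (inj₂ refl) (inj₁ refl) = a≢c refl
three-distinct-in-pair _   _   b≢c (inj₁ refl) (inj₂ refl) (inj₂ refl) = b≢c refl
three-distinct-in-pair _   _   b≢c (inj₂ refl) (inj₁ refl) (inj₁ refl) = b≢c refl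
three-distinct-in-pair _   a≢c _   (inj₂ refl) (inj₁ refl) (inj₂ refl) = a≢c refl

splitAt-injective : ∀ m {n} {i i′ : Fin (m + n)} → splitAt m i ≡ splitAt m i′ → i ≡ i′
splitAt-injective m {n} {i} {i′} e =
  trans (sym (join-splitAt m n i)) (trans (cong (join m n) e) (join-splitAt m n i′))

[,]-injective : ∀ {A B C : Set} {f : A → C} {g : B → C} →
                (∀ {x x′} → f x ≡ f x′ → x ≡ x′) → (∀ {y y′} → g y ≡ g y′ → y ≡ y′) → (∀ {x y} → f x ≢ g y) →
                ∀ {z z′} → [ f , g ]′ z ≡ [ f , g ]′ z′ → z ≡ z′
[,]-injective f-inj _     _   {inj₁ _} {inj₁ _} e = cong inj₁ (f-inj e)
[,]-injective _     g-inj _   {inj₂ _} {inj₂ _} e = cong inj₂ (g-inj e)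
[,]-injective _     _     f≢g {inj₁ _} {inj₂ _} e = ⊥-elim (f≢g e)
[,]-injective _     _     f≢g {inj₂ _} {inj₁ _} e = ⊥-elim (f≢g (sym e))

⊎-↔-Fin : ∀ {A B : Set} {m k} → A ↔ Fin m → B ↔ Fin k → (A ⊎ B) ↔ Fin (m + k)
⊎-↔-Fin A↔ B↔ = ↔-trans (A↔ ⊎-↔ B↔) (↔-sym +↔⊎)

same-quartet : ∀ {X : Set} {a b c d a′ b′ c′ d′ : X} → a ≡ a′ → b ≡ b′ → c ≡ c′ → d ≡ d′ →
               SameQuartet (a ∙ b ∣ c ∙ d) (a′ ∙ b′ ∣ c′ ∙ d′)
same-quartet refl refl refl refl = inj₁ (inj₁ (refl , refl) , inj₁ (refl , refl))

data Descendant {A : Set} (parent : A → Maybe A) : A → A → Set where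
  self : ∀ {x} → Descendant parent x x
  up   : ∀ {x y z} → parent x ≡ just y → Descendant parent y z → Descendant parent x z

module _ {A : Set} {parent : A → Maybe A} where

  descendant-trans : ∀ {x y z} → Descendant parent x y → Descendant parent y z → Descendant parent x z
  descendant-trans self     e = e
  descendant-trans (up p d) e = up p (descendant-trans d e)

  closed⇒¬descendant : (P : A → Set) → (∀ {y z} → parent y ≡ just z → P y → P z) →
                       ∀ {y x} → P y → ¬ P x → ¬ Descendant parent y x
  closed⇒¬descendant P closed py ¬px self     = ¬px py
  closed⇒¬descendant P closed py ¬px (up p d) = closed⇒¬descendant P closed (closed p py) ¬px d

descendant-map : ∀ {A B : Set} {parentA : A → Maybe A} {parentB : B → Maybe B} (f : A → B) →
                 (∀ {x y} → parentA x ≡ just y → parentB (f x) ≡ just (f y)) →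
                 ∀ {x y} → Descendant parentA x y → Descendant parentB (f x) (f y)
descendant-map f hom self     = self
descendant-map f hom (up p d) = up (hom p) (descendant-map f hom d)

module ParentTree {n : ℕ} (parent : Fin n → Maybe (Fin n)) (root : Fin n)
  (root-orphan : parent root ≡ nothing)
  (reaches-root : ∀ x → Descendant parent x root) where

  infix 4 _≼_
  _≼_ : Fin n → Fin n → Set
  x ≼ y = Descendant parent x y

  length : ∀ {x y} → x ≼ y → ℕ
  length self     = zero
  length (up _ e) = suc (length e)

  length-to-root-unique : ∀ {x} (e e′ : x ≼ root) → length e ≡ length e′
  length-to-root-unique self     self       = refl
  length-to-root-unique self     (up p _)   with trans (sym root-orphan) p
  ... | ()
  length-to-root-unique (up p _) self       with trans (sym root-orphan) p
  ... | ()
  length-to-root-unique (up p e) (up p′ e′) with just-injective (trans (sym p) p′)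
  ... | refl = cong suc (length-to-root-unique e e′)

  depth : Fin n → ℕ
  depth x = length (reaches-root x)

  depth-parent : ∀ {x p} → parent x ≡ just p → depth x ≡ suc (depth p)
  depth-parent {x} {p} e = length-to-root-unique (reaches-root x) (up e (reaches-root p))

  parent-shallower : ∀ {x p} → parent x ≡ just p → depth p < depth x
  parent-shallower e = ≤-reflexive (sym (depth-parent e))

  depth-antitone : ∀ {x y} → x ≼ y → depth y ≤ depth x
  depth-antitone self     = ≤-refl
  depth-antitone (up p e) = ≤-trans (depth-antitone e) (<⇒≤ (parent-shallower p))

  parent-¬≼ : ∀ {x p} → parent x ≡ just p → ¬ p ≼ x
  parent-¬≼ e p≼x = <-irrefl refl (<-≤-trans (parent-shallower e) (depth-antitone p≼x))

  ≼-depth-injective : ∀ {v w w′} → v ≼ w → v ≼ w′ → depth w ≡ depth w′ → w ≡ w′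
  ≼-depth-injective self     self       _  = refl
  ≼-depth-injective self     (up p e)   eq =
    ⊥-elim (<-irrefl (sym eq) (≤-<-trans (depth-antitone e) (parent-shallower p)))
  ≼-depth-injective (up p e) self       eq =
    ⊥-elim (<-irrefl eq (≤-<-trans (depth-antitone e) (parent-shallower p)))
  ≼-depth-injective (up p e) (up p′ e′) eq with just-injective (trans (sym p) p′)
  ... | refl = ≼-depth-injective e e′ eq

  Adj : Fin n → Fin n → Set
  Adj x y = parent x ≡ just y ⊎ parent y ≡ just x

  Adj-sym : ∀ {x y} → Adj x y → Adj y x
  Adj-sym (inj₁ p) = inj₂ p
  Adj-sym (inj₂ p) = inj₁ p

  Adj-irrefl : ∀ {x} → ¬ Adj x x
  Adj-irrefl (inj₁ p) = <-irrefl refl (parent-shallower p)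
  Adj-irrefl (inj₂ p) = <-irrefl refl (parent-shallower p)

  graph : Graph n
  graph = record { Adj = Adj ; symm = Adj-sym ; irrefl = Adj-irrefl }

  ¬≼-along-edge : ∀ {x h w} → Adj h w → x ≢ w → ¬ h ≼ x → ¬ w ≼ x
  ¬≼-along-edge (inj₁ p) _   ¬h≼x w≼x      = ¬h≼x (up p w≼x)
  ¬≼-along-edge (inj₂ p) x≢w _    self     = x≢w refl
  ¬≼-along-edge (inj₂ p) _   ¬h≼x (up q e) with just-injective (trans (sym q) p)
  ... | refl = ¬h≼x e

  avoiding-path-stays-outside : ∀ {x} h rest → Linked Adj (h ∷ rest) → All (x ≢_) rest →
                                ¬ h ≼ x → All (λ z → ¬ z ≼ x) (h ∷ rest)
  avoiding-path-stays-outside h []         _        _          ¬h≼x = ¬h≼x ∷ []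
  avoiding-path-stays-outside h (w ∷ rest) (a ∷ lk) (x≢w ∷ al) ¬h≼x =
    ¬h≼x ∷ avoiding-path-stays-outside w rest lk al (¬≼-along-edge a x≢w ¬h≼x)

  -- Stepping back up from w would revisit h.
  stays-below : ∀ h w rest → Linked Adj (h ∷ w ∷ rest) → Unique (h ∷ w ∷ rest) →
                parent w ≡ just h → All (_≼ w) (w ∷ rest)
  stays-below h w []         _                 _                   _ = self ∷ []
  stays-below h w (z ∷ rest) (_ ∷ inj₁ q ∷ _)  ((_ ∷ h≢z ∷ _) ∷ _) p with just-injective (trans (sym p) q)
  ... | refl = ⊥-elim (h≢z refl)
  stays-below h w (z ∷ rest) (_ ∷ inj₂ q ∷ lk) (_ ∷ un)            p =
    self ∷ All.map (λ e → descendant-trans e (up q self)) (stays-below w z rest (inj₂ q ∷ lk) un q)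

  leaves-subtree : ∀ h w rest → Linked Adj (h ∷ w ∷ rest) → Unique (h ∷ w ∷ rest) →
                   parent h ≡ just w → All (λ z → ¬ z ≼ h) (w ∷ rest)
  leaves-subtree h w rest (_ ∷ lk) ((_ ∷ h∉rest) ∷ _) p =
    avoiding-path-stays-outside w rest lk h∉rest (parent-¬≼ p)

  second-vertex-unique : ∀ {v} x w w′ xs ys → Adj x w → Adj x w′ →
    Linked Adj (w ∷ xs) → Linked Adj (w′ ∷ ys) → Unique (x ∷ w ∷ xs) → Unique (x ∷ w′ ∷ ys) →
    last (w ∷ xs) ≡ just v → last (w′ ∷ ys) ≡ just v → w ≡ w′
  second-vertex-unique x w w′ xs ys (inj₁ p) (inj₁ p′) _ _ _ _ _ _ = just-injective (trans (sym p) p′)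
  second-vertex-unique x w w′ xs ys (inj₂ p) (inj₂ p′) lk lk′ un un′ e e′ =
    ≼-depth-injective (All-last (stays-below x w xs (inj₂ p ∷ lk) un p) e)
                      (All-last (stays-below x w′ ys (inj₂ p′ ∷ lk′) un′ p′) e′)
                      (trans (depth-parent p) (sym (depth-parent p′)))
  second-vertex-unique x w w′ xs ys (inj₁ p) (inj₂ p′) lk lk′ un un′ e e′ =
    ⊥-elim (All-last (leaves-subtree x w xs (inj₁ p ∷ lk) un p) e
             (descendant-trans (All-last (stays-below x w′ ys (inj₂ p′ ∷ lk′) un′ p′) e′) (up p′ self)))
  second-vertex-unique x w w′ xs ys (inj₂ p) (inj₁ p′) lk lk′ un un′ e e′ =
    ⊥-elim (All-last (leaves-subtree x w′ ys (inj₁ p′ ∷ lk′) un′ p′) e′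
             (descendant-trans (All-last (stays-below x w xs (inj₂ p ∷ lk) un p) e) (up p self)))

  path-unique : ∀ {u v} xs ys → IsPath graph u v xs → IsPath graph u v ys → xs ≡ ys
  path-unique []      _  (_ , _ , () , _) _
  path-unique (_ ∷ _) [] _                (_ , _ , () , _)
  path-unique (x ∷ []) (y ∷ []) (_ , _ , refl , _) (_ , _ , refl , _) = refl
  path-unique (x ∷ []) (y ∷ w ∷ ys) (_ , _ , refl , refl) (_ , (x∉ ∷ _) , refl , e) = ⊥-elim (All-last x∉ e refl)
  path-unique (x ∷ w ∷ xs) (y ∷ []) (_ , (x∉ ∷ _) , refl , e) (_ , _ , refl , refl) = ⊥-elim (All-last x∉ e refl)
  path-unique (x ∷ w ∷ xs) (y ∷ w′ ∷ ys)
              (a ∷ lk , un@(_ ∷ un₁) , refl , e) (a′ ∷ lk′ , un′@(_ ∷ un₁′) , refl , e′) =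
    cong (x ∷_) (path-unique (w ∷ xs) (w′ ∷ ys) (lk , un₁ , refl , e)
      (lk′ , un₁′ , cong just (sym (second-vertex-unique x w w′ xs ys a a′ lk lk′ un un′ e e′)) , e′))

  Walk : Fin n → Fin n → List (Fin n) → Set
  Walk u v ws = Linked Adj (u ∷ ws) × last (u ∷ ws) ≡ just v

  walk-snoc : ∀ {u v w} ws → Walk u v ws → Adj v w → Walk u w (ws ++ w ∷ [])
  walk-snoc []       ([-] , refl)  a = a ∷ [-] , refl
  walk-snoc (x ∷ ws) (a′ ∷ lk , e) a with walk-snoc ws (lk , e) a
  ... | lk′ , e′ = a′ ∷ lk′ , e′

  walk-up : ∀ {u v} → u ≼ v → ∃ (Walk u v)
  walk-up self             = [] , [-] , refl
  walk-up (up {y = y} p e) with walk-up e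
  ... | ws , lk , l = y ∷ ws , inj₁ p ∷ lk , l

  walk-via-root : ∀ u {v} → v ≼ root → ∃ (Walk u v)
  walk-via-root u self             = walk-up (reaches-root u)
  walk-via-root u (up {x = v} p e) with walk-via-root u e
  ... | ws , w = ws ++ v ∷ [] , walk-snoc ws w (inj₂ p)

  path-from-member : ∀ {x} ps → x ∈ ps → Linked Adj ps → Unique ps →
                     ∃ λ qs → Linked Adj qs × Unique qs × head qs ≡ just x × last qs ≡ last ps
  path-from-member (p ∷ ps)     (here refl) lk       un       = p ∷ ps , lk , un , refl , refl
  path-from-member (p ∷ q ∷ ps) (there m)   (_ ∷ lk) (_ ∷ un) = path-from-member (q ∷ ps) m lk un

  walk⇒path : ∀ {u v} ws → Walk u v ws → ∃ (IsPath graph u v)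
  walk⇒path {u} []       (lk , e)     = u ∷ [] , [-] , [] ∷ [] , refl , e
  walk⇒path {u} (y ∷ ws) (a ∷ lk , e) with walk⇒path ws (lk , e)
  ... | [] , _ , _ , () , _
  ... | p ∷ ps , lk′ , un , refl , e′ with any? (u ≟_) (p ∷ ps)
  ...   | yes u∈ with path-from-member (p ∷ ps) u∈ lk′ un
  ...     | qs , lk″ , un″ , h , e″ = qs , lk″ , un″ , h , trans e″ e′
  walk⇒path {u} (y ∷ ws) (a ∷ lk , e) | p ∷ ps , lk′ , un , refl , e′ | no u∉ =
    u ∷ p ∷ ps , a ∷ lk′ , ¬Any⇒All¬ (p ∷ ps) u∉ ∷ un , refl , e′

  isTree : IsTree graph
  isTree = (λ u v → let ws , w = walk-via-root u (reaches-root v) in walk⇒path ws w)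
         , (λ u v xs ys → path-unique xs ys)

  path-within-subtree : ∀ {x e} h rest → Linked Adj (h ∷ rest) → Unique (h ∷ rest) → h ≼ x →
                        last (h ∷ rest) ≡ just e → e ≼ x → All (_≼ x) (h ∷ rest)
  path-within-subtree h []         _             _        h≼x _ _ = h≼x ∷ []
  path-within-subtree h (w ∷ rest) (inj₁ p ∷ lk) un       self l e≼h =
    ⊥-elim (All-last (leaves-subtree h w rest (inj₁ p ∷ lk) un p) l e≼h)
  path-within-subtree h (w ∷ rest) (inj₂ p ∷ lk) un       self _ _ =
    self ∷ All.map (λ z → descendant-trans z (up p self)) (stays-below h w rest (inj₂ p ∷ lk) un p)
  path-within-subtree h (w ∷ rest) (inj₁ p ∷ lk) (_ ∷ un) (up q w≼x) l e≼x with just-injective (trans (sym q) p)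
  ... | refl = up q w≼x ∷ path-within-subtree w rest lk un w≼x l e≼x
  path-within-subtree h (w ∷ rest) (inj₂ p ∷ lk) (_ ∷ un) h≼x@(up _ _) l e≼x =
    h≼x ∷ path-within-subtree w rest lk un (up p h≼x) l e≼x

  second-outside-subtree : ∀ {x e} h w rest → Linked Adj (h ∷ w ∷ rest) → Unique (h ∷ w ∷ rest) → ¬ h ≼ x →
                           last (w ∷ rest) ≡ just e → ¬ e ≼ x → ¬ w ≼ x
  second-outside-subtree h w rest (inj₁ p ∷ _)  _  ¬h≼x _ _    w≼x      = ¬h≼x (up p w≼x)
  second-outside-subtree h w rest (inj₂ p ∷ lk) un _    l ¬e≼x self     =
    ¬e≼x (All-last (stays-below h w rest (inj₂ p ∷ lk) un p) l)
  second-outside-subtree h w rest (inj₂ p ∷ _)  _  ¬h≼x _ _    (up q e) with just-injective (trans (sym q) p)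
  ... | refl = ¬h≼x e

  path-outside-subtree : ∀ {x e} h rest → Linked Adj (h ∷ rest) → Unique (h ∷ rest) → ¬ h ≼ x →
                         last (h ∷ rest) ≡ just e → ¬ e ≼ x → All (λ z → ¬ z ≼ x) (h ∷ rest)
  path-outside-subtree h []         _            _            ¬h≼x _ _    = ¬h≼x ∷ []
  path-outside-subtree h (w ∷ rest) lk@(_ ∷ lk′) un@(_ ∷ un′) ¬h≼x l ¬e≼x =
    ¬h≼x ∷ path-outside-subtree w rest lk′ un′ (second-outside-subtree h w rest lk un ¬h≼x l ¬e≼x) l ¬e≼x

  subtree-separates : ∀ {a b c d x} → a ≼ x → b ≼ x → ¬ c ≼ x → ¬ d ≼ x →
                      ∀ xs ys → IsPath graph a b xs → IsPath graph c d ys → Disjoint xs ys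
  subtree-separates a≼x b≼x ¬c≼x ¬d≼x (x ∷ xs) (y ∷ ys) (lk , un , refl , l) (lk′ , un′ , refl , l′) z z∈xs z∈ys =
    All.lookup (path-outside-subtree y ys lk′ un′ ¬c≼x l′ ¬d≼x) z∈ys
               (All.lookup (path-within-subtree x xs lk un a≼x l b≼x) z∈xs)

Branching : {V : Set} → (V → Maybe V) → V → Set
Branching {V} parent w = Σ V λ c₁ → Σ V λ c₂ → c₁ ≢ c₂ × parent c₁ ≡ just w × parent c₂ ≡ just w ×
  ((∃ λ p → parent w ≡ just p) ⊎ (∃ λ c₃ → c₃ ≢ c₁ × c₃ ≢ c₂ × parent c₃ ≡ just w))

module FromParents {X V : Set} {n : ℕ} (V↔Fin : V ↔ Fin n)
  (parent : V → Maybe V) (root : V) (root-orphan : parent root ≡ nothing)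
  (reaches-root : ∀ v → Descendant parent v root)
  (label : X → V) (label-injective : ∀ {x y} → label x ≡ label y → x ≡ y)
  (label-has-parent : ∀ x → ∃ λ p → parent (label x) ≡ just p)
  (label-childless : ∀ x w → parent w ≢ just (label x))
  (label-or-branching : ∀ w → (∃ λ x → label x ≡ w) ⊎ Branching parent w) where

  open Inverse V↔Fin using (to; from; strictlyInverseˡ; strictlyInverseʳ)

  infix 4 _≼_
  _≼_ : V → V → Set
  v ≼ w = Descendant parent v w

  to-injective : ∀ {v w} → to v ≡ to w → v ≡ w
  to-injective {v} {w} e = trans (sym (strictlyInverseʳ v)) (trans (cong from e) (strictlyInverseʳ w))

  parentF : Fin n → Maybe (Fin n)
  parentF x = Maybe.map to (parent (from x))

  parentF-to : ∀ {v p} → parent v ≡ just p → parentF (to v) ≡ just (to p)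
  parentF-to {v} e rewrite strictlyInverseʳ v | e = refl

  parentF-from : ∀ {x y} → parentF x ≡ just y → parent (from x) ≡ just (from y)
  parentF-from {x} e with parent (from x)
  parentF-from {x} refl | just p = cong just (sym (strictlyInverseʳ p))

  parentF-child : ∀ {c v} → parent c ≡ just (from v) → parentF (to c) ≡ just v
  parentF-child e = trans (parentF-to e) (cong just (strictlyInverseˡ _))

  ≼-to : ∀ {v w} → v ≼ w → Descendant parentF (to v) (to w)
  ≼-to = descendant-map to parentF-to

  ¬≼-to : ∀ {v w} → ¬ v ≼ w → ¬ Descendant parentF (to v) (to w)
  ¬≼-to {v} {w} ¬v≼w d = ¬v≼w (subst₂ _≼_ (strictlyInverseʳ v) (strictlyInverseʳ w)
                                          (descendant-map from parentF-from d))

  root-orphanF : parentF (to root) ≡ nothing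
  root-orphanF rewrite strictlyInverseʳ root | root-orphan = refl

  reaches-rootF : ∀ x → Descendant parentF x (to root)
  reaches-rootF x = subst (λ y → Descendant parentF y (to root)) (strictlyInverseˡ x) (≼-to (reaches-root (from x)))

  open ParentTree parentF (to root) root-orphanF reaches-rootF
    using (Adj; graph; isTree; parent-shallower; subtree-separates)

  no-2-cycle : ∀ {x y} → parentF x ≡ just y → parentF y ≡ just x → ⊥
  no-2-cycle p q = <-irrefl refl (≤-<-trans (<⇒≤ (parent-shallower p)) (parent-shallower q))

  label-neighbour : ∀ x {p} → parent (label x) ≡ just p → ∀ y → Adj (to (label x)) y → y ≡ to p
  label-neighbour x e y (inj₁ q) = just-injective (trans (sym q) (parentF-to e))
  label-neighbour x e y (inj₂ q) =
    ⊥-elim (label-childless x (from y) (trans (parentF-from q) (cong just (strictlyInverseʳ (label x)))))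

  branching-neighbours : ∀ v → Branching parent (from v) → Σ (Fin n) λ a → Σ (Fin n) λ b → Σ (Fin n) λ c →
                         a ≢ b × a ≢ c × b ≢ c × Adj v a × Adj v b × Adj v c
  branching-neighbours v (c₁ , c₂ , c₁≢c₂ , p₁ , p₂ , inj₁ (p , pp)) =
    to c₁ , to c₂ , to p , (λ e → c₁≢c₂ (to-injective e)) ,
    (λ e → no-2-cycle (subst (λ z → parentF z ≡ just v) e (parentF-child p₁)) pv) ,
    (λ e → no-2-cycle (subst (λ z → parentF z ≡ just v) e (parentF-child p₂)) pv) ,
    inj₂ (parentF-child p₁) , inj₂ (parentF-child p₂) , inj₁ pv
    where
    pv : parentF v ≡ just (to p)
    pv = subst (λ z → parentF z ≡ just (to p)) (strictlyInverseˡ v) (parentF-to pp)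
  branching-neighbours v (c₁ , c₂ , c₁≢c₂ , p₁ , p₂ , inj₂ (c₃ , c₃≢c₁ , c₃≢c₂ , p₃)) =
    to c₁ , to c₂ , to c₃ , (λ e → c₁≢c₂ (to-injective e)) ,
    (λ e → c₃≢c₁ (sym (to-injective e))) , (λ e → c₃≢c₂ (sym (to-injective e))) ,
    inj₂ (parentF-child p₁) , inj₂ (parentF-child p₂) , inj₂ (parentF-child p₃)

  no-degree-two : ∀ v → ¬ DegreeTwo graph v
  no-degree-two v (x , y , x≢y , ax , ay , only) with label-or-branching (from v)
  ... | inj₁ (l , e) =
    let p , pe = label-has-parent l
        nbr : ∀ z → Adj v z → z ≡ to p
        nbr z a = label-neighbour l pe z (subst (λ w → Adj w z) (sym (trans (cong to e) (strictlyInverseˡ v))) a)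
    in x≢y (trans (nbr x ax) (sym (nbr y ay)))
  ... | inj₂ br with branching-neighbours v br
  ...   | a , b , c , a≢b , a≢c , b≢c , aa , ab , ac =
    three-distinct-in-pair a≢b a≢c b≢c (only a aa) (only b ab) (only c ac)

  label-leaf : ∀ x → IsLeaf graph (to (label x))
  label-leaf x = let p , pe = label-has-parent x in to p , inj₁ (parentF-to pe) , label-neighbour x pe

  leaf-labelled : ∀ v → IsLeaf graph v → ∃ λ x → to (label x) ≡ v
  leaf-labelled v (z , _ , only) with label-or-branching (from v)
  ... | inj₁ (x , e) = x , trans (cong to e) (strictlyInverseˡ v)
  ... | inj₂ br with branching-neighbours v br
  ...   | a , b , _ , a≢b , _ , _ , aa , ab , _ = ⊥-elim (a≢b (trans (only a aa) (sym (only b ab))))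

  tree : PhyloTree X
  tree = record
    { n = n ; graph = graph ; isTree = isTree ; noDeg2 = no-degree-two
    ; label = λ x → to (label x)
    ; labelInj = λ e → label-injective (to-injective e)
    ; labelLeaf = label-leaf ; leafLabel = leaf-labelled }

  Separates : V → Quartet X → Set
  Separates w (a ∙ b ∣ c ∙ d) = label a ≼ w × label b ≼ w × ¬ label c ≼ w × ¬ label d ≼ w
                              ⊎ ¬ label a ≼ w × ¬ label b ≼ w × label c ≼ w × label d ≼ w

  separated⇒displayed : ∀ {w} q → Separates w q → Displays tree q
  separated⇒displayed (a ∙ b ∣ c ∙ d) (inj₁ (a≼w , b≼w , ¬c≼w , ¬d≼w)) =
    subtree-separates (≼-to a≼w) (≼-to b≼w) (¬≼-to ¬c≼w) (¬≼-to ¬d≼w)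
  separated⇒displayed (a ∙ b ∣ c ∙ d) (inj₂ (¬a≼w , ¬b≼w , c≼w , d≼w)) xs ys pxs pys z z∈xs z∈ys =
    subtree-separates (≼-to c≼w) (≼-to d≼w) (¬≼-to ¬a≼w) (¬≼-to ¬b≼w) ys xs pys pxs z z∈ys z∈xs

-- Leaves inj₁ j and spine nodes inj₂ m. The caterpillar on k + 2 leaves is the one on k + 1 leaves,
-- shifted, hung together with the new leaf inj₁ 0 below the new top inj₂ 0.
Caterpillar : ℕ → Set
Caterpillar k = Fin (suc k) ⊎ Fin k

shift : ∀ {k} → Caterpillar k → Caterpillar (suc k)
shift (inj₁ j) = inj₁ (suc j)
shift (inj₂ m) = inj₂ (suc m)

shift-injective : ∀ {k} {c c′ : Caterpillar k} → shift c ≡ shift c′ → c ≡ c′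
shift-injective {c = inj₁ _} {inj₁ _} refl = refl
shift-injective {c = inj₂ _} {inj₂ _} refl = refl

hang-below-top : ∀ {k} → Maybe (Caterpillar k) → Caterpillar (suc k)
hang-below-top nothing  = inj₂ zero
hang-below-top (just c) = shift c

cat-parent : ∀ {k} → Caterpillar k → Maybe (Caterpillar k)
cat-parent {zero}  (inj₁ zero)    = nothing
cat-parent {suc k} (inj₁ zero)    = just (inj₂ zero)
cat-parent {suc k} (inj₁ (suc j)) = just (hang-below-top (cat-parent {k} (inj₁ j)))
cat-parent {suc k} (inj₂ zero)    = nothing
cat-parent {suc k} (inj₂ (suc m)) = just (hang-below-top (cat-parent {k} (inj₂ m)))

cat-parent-shift : ∀ {k} (c : Caterpillar k) → cat-parent (shift c) ≡ just (hang-below-top (cat-parent c))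
cat-parent-shift (inj₁ _) = refl
cat-parent-shift (inj₂ _) = refl

cat-top : ∀ {k} → Caterpillar k
cat-top {zero}  = inj₁ zero
cat-top {suc k} = inj₂ zero

cat-top-orphan : ∀ {k} → cat-parent (cat-top {k}) ≡ nothing
cat-top-orphan {zero}  = refl
cat-top-orphan {suc k} = refl

cat-parent-shift-just : ∀ {k} {c p : Caterpillar k} → cat-parent c ≡ just p → cat-parent (shift c) ≡ just (shift p)
cat-parent-shift-just {c = c} e = trans (cat-parent-shift c) (cong (λ p → just (hang-below-top p)) e)

cat-parent-shift-top : ∀ {k} → cat-parent (shift (cat-top {k})) ≡ just (inj₂ zero)
cat-parent-shift-top {k} = trans (cat-parent-shift (cat-top {k})) (cong (λ p → just (hang-below-top p)) (cat-top-orphan {k}))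

mutual
  cat-reaches-top : ∀ {k} (c : Caterpillar k) → Descendant cat-parent c cat-top
  cat-reaches-top {zero}  (inj₁ zero)    = self
  cat-reaches-top {suc k} (inj₁ zero)    = up refl self
  cat-reaches-top {suc k} (inj₂ zero)    = self
  cat-reaches-top {suc k} (inj₁ (suc j)) = shift-reaches-top (inj₁ j)
  cat-reaches-top {suc k} (inj₂ (suc m)) = shift-reaches-top (inj₂ m)

  shift-reaches-top : ∀ {k} (c : Caterpillar k) → Descendant cat-parent (shift c) (cat-top {suc k})
  shift-reaches-top {k} c =
    descendant-trans (descendant-map shift cat-parent-shift-just (cat-reaches-top c))
                     (up (cat-parent-shift-top {k}) self)

cat-parent-is-spine : ∀ {k} (c : Caterpillar k) {p} → cat-parent c ≡ just p → ∃ λ m → p ≡ inj₂ m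
cat-parent-is-spine {suc k} (inj₁ zero) refl = zero , refl
cat-parent-is-spine {suc k} (inj₁ (suc j)) e with cat-parent {k} (inj₁ j) in eq
cat-parent-is-spine {suc k} (inj₁ (suc j)) refl | nothing = zero , refl
cat-parent-is-spine {suc k} (inj₁ (suc j)) refl | just _ with cat-parent-is-spine (inj₁ j) eq
... | m , refl = suc m , refl
cat-parent-is-spine {suc k} (inj₂ (suc m)) e with cat-parent {k} (inj₂ m) in eq
cat-parent-is-spine {suc k} (inj₂ (suc m)) refl | nothing = zero , refl
cat-parent-is-spine {suc k} (inj₂ (suc m)) refl | just _ with cat-parent-is-spine (inj₂ m) eq
... | m′ , refl = suc m′ , refl

spine-two-children : ∀ {k} (m : Fin k) → Σ (Caterpillar k) λ c₁ → Σ (Caterpillar k) λ c₂ →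
                     c₁ ≢ c₂ × cat-parent c₁ ≡ just (inj₂ m) × cat-parent c₂ ≡ just (inj₂ m)
spine-two-children {suc k} zero = inj₁ zero , shift (cat-top {k}) , leaf≢shift-top k , refl , cat-parent-shift-top {k}
  where
  leaf≢shift-top : ∀ k → inj₁ zero ≢ shift (cat-top {k})
  leaf≢shift-top zero    ()
  leaf≢shift-top (suc k) ()
spine-two-children {suc k} (suc m) with spine-two-children m
... | c₁ , c₂ , c₁≢c₂ , p₁ , p₂ =
  shift c₁ , shift c₂ , (λ e → c₁≢c₂ (shift-injective e)) , cat-parent-shift-just p₁ , cat-parent-shift-just p₂

module EndsTree (s′ t′ : ℕ) where

  s t : ℕ
  s = suc (suc s′)
  t = suc (suc t′)

  V : Set
  V = Fin s ⊎ (Fin t ⊎ Fin 2)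

  hubA hubB : V
  hubA = inj₂ (inj₂ zero)
  hubB = inj₂ (inj₂ (suc zero))

  parent : V → Maybe V
  parent (inj₁ _)                = just hubA
  parent (inj₂ (inj₁ _))         = just hubB
  parent (inj₂ (inj₂ zero))       = nothing
  parent (inj₂ (inj₂ (suc zero))) = just hubA

  reaches-hubA : ∀ v → Descendant parent v hubA
  reaches-hubA (inj₁ _)                = up refl self
  reaches-hubA (inj₂ (inj₁ _))         = up refl (up refl self)
  reaches-hubA (inj₂ (inj₂ zero))       = self
  reaches-hubA (inj₂ (inj₂ (suc zero))) = up refl self

  label : L s t → V
  label (inj₁ i) = inj₁ i
  label (inj₂ j) = inj₂ (inj₁ j)

  label-injective : ∀ {x y} → label x ≡ label y → x ≡ y
  label-injective {inj₁ _} {inj₁ _} refl = refl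
  label-injective {inj₂ _} {inj₂ _} refl = refl

  label-has-parent : ∀ x → ∃ λ p → parent (label x) ≡ just p
  label-has-parent (inj₁ _) = hubA , refl
  label-has-parent (inj₂ _) = hubB , refl

  label-childless : ∀ x w → parent w ≢ just (label x)
  label-childless (inj₁ _) (inj₁ _)                ()
  label-childless (inj₁ _) (inj₂ (inj₁ _))         ()
  label-childless (inj₁ _) (inj₂ (inj₂ (suc zero))) ()
  label-childless (inj₂ _) (inj₁ _)                ()
  label-childless (inj₂ _) (inj₂ (inj₁ _))         ()
  label-childless (inj₂ _) (inj₂ (inj₂ (suc zero))) ()

  label-or-branching : ∀ w → (∃ λ x → label x ≡ w) ⊎ Branching parent w
  label-or-branching (inj₁ i)                = inj₁ (inj₁ i , refl)
  label-or-branching (inj₂ (inj₁ j))         = inj₁ (inj₂ j , refl)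
  label-or-branching (inj₂ (inj₂ zero))       =
    inj₂ (inj₁ zero , inj₁ (suc zero) , (λ ()) , refl , refl , inj₂ (hubB , (λ ()) , (λ ()) , refl))
  label-or-branching (inj₂ (inj₂ (suc zero))) =
    inj₂ (inj₂ (inj₁ zero) , inj₂ (inj₁ (suc zero)) , (λ ()) , refl , refl , inj₁ (hubA , refl))

  open FromParents (⊎-↔-Fin ↔-refl (⊎-↔-Fin ↔-refl ↔-refl)) parent hubA refl reaches-hubA
                   label label-injective label-has-parent label-childless label-or-branching
    using (tree; separated⇒displayed)

  a-not-below-hubB : ∀ i → ¬ Descendant parent (inj₁ i) hubB
  a-not-below-hubB i (up refl (up () _))

  compatible-without-ends : ∀ i₁ iₛ j₁ jₜ → toℕ i₁ ≡ 0 → toℕ iₛ ≡ suc s′ → toℕ j₁ ≡ 0 → toℕ jₜ ≡ suc t′ →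
    Compatible (λ q′ → Q s t q′ × ¬ SameQuartet q′ (aL i₁ ∙ bL j₁ ∣ aL iₛ ∙ bL jₜ))
  compatible-without-ends i₁ iₛ j₁ jₜ e₁ eₛ f₁ fₜ = tree , displays-rest
    where
    displays-rest : ∀ q → Q s t q × ¬ SameQuartet q (aL i₁ ∙ bL j₁ ∣ aL iₛ ∙ bL jₜ) → Displays tree q
    displays-rest _ (ends _ _ _ _ e₁′ eₛ′ f₁′ fₜ′ , ≠q) =
      ⊥-elim (≠q (same-quartet (cong inj₁ (toℕ-injective (trans e₁′ (sym e₁))))
                               (cong inj₂ (toℕ-injective (trans f₁′ (sym f₁))))
                               (cong inj₁ (toℕ-injective (trans eₛ′ (sym eₛ))))
                               (cong inj₂ (toℕ-injective (trans fₜ′ (sym fₜ))))))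
    displays-rest q (mid i i′ _ _ _ _ , _) =
      separated⇒displayed q (inj₂ (a-not-below-hubB i , a-not-below-hubB i′ , up refl self , up refl self))

module Split {V : Set} {m m′ : ℕ} (f : Fin m → V) (g : Fin m′ → V) where

  place : Fin (m + m′) → V
  place i = [ f , g ]′ (splitAt m i)

  place-elim : (P : V → Set) → (∀ x → P (f x)) → (∀ y → P (g y)) → ∀ i → P (place i)
  place-elim P pf pg i with splitAt m i
  ... | inj₁ x = pf x
  ... | inj₂ y = pg y

  place-low : (P : V → Set) → (∀ x → P (f x)) → ∀ i → toℕ i < m → P (place i)
  place-low P pf i lt rewrite splitAt-< m i lt = pf _

  place-high : (P : V → Set) → (∀ y → P (g y)) → ∀ i → m ≤ toℕ i → P (place i)
  place-high P pg i ge rewrite splitAt-≥ m i ge = pg _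

  place-left : ∀ x → place (x ↑ˡ m′) ≡ f x
  place-left x = cong [ f , g ]′ (splitAt-↑ˡ m x m′)

  place-right : ∀ y → place (m ↑ʳ y) ≡ g y
  place-right y = cong [ f , g ]′ (splitAt-↑ʳ m m′ y)

  place-injective : (∀ {x x′} → f x ≡ f x′ → x ≡ x′) → (∀ {y y′} → g y ≡ g y′ → y ≡ y′) → (∀ {x y} → f x ≢ g y) →
                    ∀ {i i′} → place i ≡ place i′ → i ≡ i′
  place-injective f-inj g-inj f≢g e = splitAt-injective m ([,]-injective f-inj g-inj f≢g e)

data Region : Set where
  a₁ a₂ b₁ b₂ u w : Region

-- r ↝ r′: a vertex of region r can have its parent in region r′.
data _↝_ : Region → Region → Set where
  within : ∀ {r} → r ↝ r
  a₁↝u   : a₁ ↝ u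
  b₁↝u   : b₁ ↝ u
  a₂↝w   : a₂ ↝ w
  b₂↝w   : b₂ ↝ w
  w↝u    : w ↝ u

↝-avoids-clade : ∀ {r x y} → r ≢ u → r ≢ w → x ↝ y → r ≢ x → r ≢ y
↝-avoids-clade _   _   within r≢x = r≢x
↝-avoids-clade r≢u _   a₁↝u   _   = r≢u
↝-avoids-clade r≢u _   b₁↝u   _   = r≢u
↝-avoids-clade _   r≢w a₂↝w   _   = r≢w
↝-avoids-clade _   r≢w b₂↝w   _   = r≢w
↝-avoids-clade r≢u _   w↝u    _   = r≢u

USide : Region → Set
USide a₁ = ⊤
USide b₁ = ⊤
USide u  = ⊤
USide _  = ⊥

↝-USide : ∀ {x y} → x ↝ y → USide x → USide y
↝-USide within p = p
↝-USide a₁↝u   _ = tt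
↝-USide b₁↝u   _ = tt
↝-USide a₂↝w   ()
↝-USide b₂↝w   ()
↝-USide w↝u    ()

module MidTree (k k′ l l′ : ℕ) where

  s t : ℕ
  s = suc k + suc k′
  t = suc l + suc l′

  V : Set
  V = (Caterpillar k ⊎ Caterpillar k′) ⊎ ((Caterpillar l ⊎ Caterpillar l′) ⊎ Fin 2)

  A₁ : Caterpillar k → V
  A₁ c = inj₁ (inj₁ c)
  A₂ : Caterpillar k′ → V
  A₂ c = inj₁ (inj₂ c)
  B₁ : Caterpillar l → V
  B₁ c = inj₂ (inj₁ (inj₁ c))
  B₂ : Caterpillar l′ → V
  B₂ c = inj₂ (inj₁ (inj₂ c))
  U W : V
  U = inj₂ (inj₂ zero)
  W = inj₂ (inj₂ (suc zero))

  hang : ∀ {m} → (Caterpillar m → V) → V → Maybe (Caterpillar m) → V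
  hang f j nothing  = j
  hang f j (just c) = f c

  parent : V → Maybe V
  parent (inj₁ (inj₁ c))         = just (hang A₁ U (cat-parent c))
  parent (inj₁ (inj₂ c))         = just (hang A₂ W (cat-parent c))
  parent (inj₂ (inj₁ (inj₁ c)))  = just (hang B₁ U (cat-parent c))
  parent (inj₂ (inj₁ (inj₂ c)))  = just (hang B₂ W (cat-parent c))
  parent (inj₂ (inj₂ zero))       = nothing
  parent (inj₂ (inj₂ (suc zero))) = just U

  infix 4 _≼_
  _≼_ : V → V → Set
  v ≼ v′ = Descendant parent v v′

  region : V → Region
  region (inj₁ (inj₁ _))         = a₁
  region (inj₁ (inj₂ _))         = a₂
  region (inj₂ (inj₁ (inj₁ _)))  = b₁
  region (inj₂ (inj₁ (inj₂ _)))  = b₂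
  region (inj₂ (inj₂ zero))       = u
  region (inj₂ (inj₂ (suc zero))) = w

  IsLeafVertex : V → Set
  IsLeafVertex (inj₁ (inj₁ (inj₁ _)))        = ⊤
  IsLeafVertex (inj₁ (inj₂ (inj₁ _)))        = ⊤
  IsLeafVertex (inj₂ (inj₁ (inj₁ (inj₁ _)))) = ⊤
  IsLeafVertex (inj₂ (inj₁ (inj₂ (inj₁ _)))) = ⊤
  IsLeafVertex _                             = ⊥

  module Embedded {m} (f : Caterpillar m → V) (j : V) (r : Region)
    (f-injective : ∀ {c c′} → f c ≡ f c′ → c ≡ c′)
    (parent-f : ∀ c → parent (f c) ≡ just (hang f j (cat-parent c)))
    (region-f : ∀ c → region (f c) ≡ r) (r↝j : r ↝ region j)
    (spine-not-leaf : ∀ m → ¬ IsLeafVertex (f (inj₂ m))) (j-not-leaf : ¬ IsLeafVertex j) where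

    parent-hom : ∀ {c c′} → cat-parent c ≡ just c′ → parent (f c) ≡ just (f c′)
    parent-hom {c} e = trans (parent-f c) (cong (λ p → just (hang f j p)) e)

    top-parent : parent (f cat-top) ≡ just j
    top-parent = trans (parent-f cat-top) (cong (λ p → just (hang f j p)) cat-top-orphan)

    below-top : ∀ c → f c ≼ f cat-top
    below-top c = descendant-map f parent-hom (cat-reaches-top c)

    below-junction : ∀ c → f c ≼ j
    below-junction c = descendant-trans (below-top c) (up top-parent self)

    spine-branching : ∀ m → Branching parent (f (inj₂ m))
    spine-branching m with spine-two-children m
    ... | c₁ , c₂ , c₁≢c₂ , p₁ , p₂ =
      f c₁ , f c₂ , (λ e → c₁≢c₂ (f-injective e)) , parent-hom p₁ , parent-hom p₂ , inj₁ (_ , parent-f (inj₂ m))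

    parent-region : ∀ c → r ↝ region (hang f j (cat-parent c))
    parent-region c with cat-parent c
    ... | nothing = r↝j
    ... | just c′ = subst (r ↝_) (sym (region-f c′)) within

    parent-not-leaf : ∀ c → ¬ IsLeafVertex (hang f j (cat-parent c))
    parent-not-leaf c with cat-parent c in eq
    ... | nothing = j-not-leaf
    ... | just _ with cat-parent-is-spine c eq
    ...   | m , refl = spine-not-leaf m

  A₁-injective : ∀ {c c′} → A₁ c ≡ A₁ c′ → c ≡ c′
  A₁-injective refl = refl
  A₂-injective : ∀ {c c′} → A₂ c ≡ A₂ c′ → c ≡ c′
  A₂-injective refl = refl
  B₁-injective : ∀ {c c′} → B₁ c ≡ B₁ c′ → c ≡ c′
  B₁-injective refl = refl
  B₂-injective : ∀ {c c′} → B₂ c ≡ B₂ c′ → c ≡ c′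
  B₂-injective refl = refl

  module EA₁ = Embedded A₁ U a₁ A₁-injective (λ _ → refl) (λ _ → refl) a₁↝u (λ _ ()) (λ ())
  module EA₂ = Embedded A₂ W a₂ A₂-injective (λ _ → refl) (λ _ → refl) a₂↝w (λ _ ()) (λ ())
  module EB₁ = Embedded B₁ U b₁ B₁-injective (λ _ → refl) (λ _ → refl) b₁↝u (λ _ ()) (λ ())
  module EB₂ = Embedded B₂ W b₂ B₂-injective (λ _ → refl) (λ _ → refl) b₂↝w (λ _ ()) (λ ())

  reaches-U : ∀ v → v ≼ U
  reaches-U (inj₁ (inj₁ c))         = EA₁.below-junction c
  reaches-U (inj₁ (inj₂ c))         = descendant-trans (EA₂.below-junction c) (up refl self)
  reaches-U (inj₂ (inj₁ (inj₁ c)))  = EB₁.below-junction c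
  reaches-U (inj₂ (inj₁ (inj₂ c)))  = descendant-trans (EB₂.below-junction c) (up refl self)
  reaches-U (inj₂ (inj₂ zero))       = self
  reaches-U (inj₂ (inj₂ (suc zero))) = up refl self

  parent-region : ∀ {x y} → parent x ≡ just y → region x ↝ region y
  parent-region {inj₁ (inj₁ c)}         refl = EA₁.parent-region c
  parent-region {inj₁ (inj₂ c)}         refl = EA₂.parent-region c
  parent-region {inj₂ (inj₁ (inj₁ c))}  refl = EB₁.parent-region c
  parent-region {inj₂ (inj₁ (inj₂ c))}  refl = EB₂.parent-region c
  parent-region {inj₂ (inj₂ (suc zero))} refl = w↝u

  parent-not-leaf : ∀ x {y} → parent x ≡ just y → ¬ IsLeafVertex y
  parent-not-leaf (inj₁ (inj₁ c))         refl = EA₁.parent-not-leaf c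
  parent-not-leaf (inj₁ (inj₂ c))         refl = EA₂.parent-not-leaf c
  parent-not-leaf (inj₂ (inj₁ (inj₁ c)))  refl = EB₁.parent-not-leaf c
  parent-not-leaf (inj₂ (inj₁ (inj₂ c)))  refl = EB₂.parent-not-leaf c
  parent-not-leaf (inj₂ (inj₂ (suc zero))) refl = λ ()

  ¬≼-clade : ∀ {r y x} → r ≢ u → r ≢ w → r ≢ region y → region x ≡ r → ¬ y ≼ x
  ¬≼-clade r≢u r≢w r≢y refl =
    closed⇒¬descendant (λ v → _ ≢ region v) (λ p → ↝-avoids-clade r≢u r≢w (parent-region p)) r≢y (λ r≢x → r≢x refl)

  ¬≼-W : ∀ {y} → USide (region y) → ¬ y ≼ W
  ¬≼-W uy = closed⇒¬descendant (λ v → USide (region v)) (λ p → ↝-USide (parent-region p)) uy (λ ())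

  module SA = Split (λ x → A₁ (inj₁ x)) (λ x → A₂ (inj₁ x))
  module SB = Split (λ x → B₁ (inj₁ x)) (λ x → B₂ (inj₁ x))

  label : L s t → V
  label = [ SA.place , SB.place ]′

  a-region : ∀ i → region (label (aL i)) ≡ a₁ ⊎ region (label (aL i)) ≡ a₂
  a-region = SA.place-elim (λ v → region v ≡ a₁ ⊎ region v ≡ a₂) (λ _ → inj₁ refl) (λ _ → inj₂ refl)

  b-region : ∀ j → region (label (bL j)) ≡ b₁ ⊎ region (label (bL j)) ≡ b₂
  b-region = SB.place-elim (λ v → region v ≡ b₁ ⊎ region v ≡ b₂) (λ _ → inj₁ refl) (λ _ → inj₂ refl)

  label-injective : ∀ {x y} → label x ≡ label y → x ≡ y
  label-injective =
    [,]-injective (SA.place-injective (λ { refl → refl }) (λ { refl → refl }) (λ ()))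
                  (SB.place-injective (λ { refl → refl }) (λ { refl → refl }) (λ ()))
                  (λ {i} {j} e → a≢b (a-region i) (b-region j) (cong region e))
    where
    a≢b : ∀ {x y} → x ≡ a₁ ⊎ x ≡ a₂ → y ≡ b₁ ⊎ y ≡ b₂ → x ≢ y
    a≢b (inj₁ refl) (inj₁ refl) ()
    a≢b (inj₁ refl) (inj₂ refl) ()
    a≢b (inj₂ refl) (inj₁ refl) ()
    a≢b (inj₂ refl) (inj₂ refl) ()

  label-elim : (P : V → Set) → (∀ x → P (A₁ (inj₁ x))) → (∀ x → P (A₂ (inj₁ x))) →
               (∀ x → P (B₁ (inj₁ x))) → (∀ x → P (B₂ (inj₁ x))) → ∀ x → P (label x)
  label-elim P pA₁ pA₂ _   _   (inj₁ i) = SA.place-elim P pA₁ pA₂ i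
  label-elim P _   _   pB₁ pB₂ (inj₂ j) = SB.place-elim P pB₁ pB₂ j

  label-has-parent : ∀ x → ∃ λ p → parent (label x) ≡ just p
  label-has-parent = label-elim (λ v → ∃ λ p → parent v ≡ just p) (λ _ → _ , refl) (λ _ → _ , refl)
                                (λ _ → _ , refl) (λ _ → _ , refl)

  label-childless : ∀ x v → parent v ≢ just (label x)
  label-childless x v e =
    parent-not-leaf v e (label-elim IsLeafVertex (λ _ → tt) (λ _ → tt) (λ _ → tt) (λ _ → tt) x)

  label-or-branching : ∀ v → (∃ λ x → label x ≡ v) ⊎ Branching parent v
  label-or-branching (inj₁ (inj₁ (inj₁ x)))        = inj₁ (aL (x ↑ˡ suc k′) , SA.place-left x)
  label-or-branching (inj₁ (inj₂ (inj₁ x)))        = inj₁ (aL (suc k ↑ʳ x) , SA.place-right x)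
  label-or-branching (inj₂ (inj₁ (inj₁ (inj₁ x)))) = inj₁ (bL (x ↑ˡ suc l′) , SB.place-left x)
  label-or-branching (inj₂ (inj₁ (inj₂ (inj₁ x)))) = inj₁ (bL (suc l ↑ʳ x) , SB.place-right x)
  label-or-branching (inj₁ (inj₁ (inj₂ m)))        = inj₂ (EA₁.spine-branching m)
  label-or-branching (inj₁ (inj₂ (inj₂ m)))        = inj₂ (EA₂.spine-branching m)
  label-or-branching (inj₂ (inj₁ (inj₁ (inj₂ m)))) = inj₂ (EB₁.spine-branching m)
  label-or-branching (inj₂ (inj₁ (inj₂ (inj₂ m)))) = inj₂ (EB₂.spine-branching m)
  label-or-branching (inj₂ (inj₂ zero))             =
    inj₂ (A₁ cat-top , B₁ cat-top , (λ ()) , EA₁.top-parent , EB₁.top-parent , inj₂ (W , (λ ()) , (λ ()) , refl))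
  label-or-branching (inj₂ (inj₂ (suc zero)))       =
    inj₂ (A₂ cat-top , B₂ cat-top , (λ ()) , EA₂.top-parent , EB₂.top-parent , inj₁ (U , refl))

  Caterpillar↔Fin : ∀ m → Caterpillar m ↔ Fin (suc m + m)
  Caterpillar↔Fin m = ⊎-↔-Fin ↔-refl ↔-refl

  open FromParents
    (⊎-↔-Fin (⊎-↔-Fin (Caterpillar↔Fin k) (Caterpillar↔Fin k′))
             (⊎-↔-Fin (⊎-↔-Fin (Caterpillar↔Fin l) (Caterpillar↔Fin l′)) ↔-refl))
    parent U refl reaches-U label label-injective label-has-parent label-childless label-or-branching
    using (tree; separated⇒displayed)

  a-below-A₁ : ∀ i → toℕ i ≤ k → label (aL i) ≼ A₁ cat-top
  a-below-A₁ i le = SA.place-low (_≼ A₁ cat-top) (λ x → EA₁.below-top (inj₁ x)) i (s≤s le)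

  a-below-A₂ : ∀ i → k < toℕ i → label (aL i) ≼ A₂ cat-top
  a-below-A₂ = SA.place-high (_≼ A₂ cat-top) (λ x → EA₂.below-top (inj₁ x))

  b-below-B₁ : ∀ j → toℕ j ≤ l → label (bL j) ≼ B₁ cat-top
  b-below-B₁ j le = SB.place-low (_≼ B₁ cat-top) (λ x → EB₁.below-top (inj₁ x)) j (s≤s le)

  b-below-B₂ : ∀ j → l < toℕ j → label (bL j) ≼ B₂ cat-top
  b-below-B₂ = SB.place-high (_≼ B₂ cat-top) (λ x → EB₂.below-top (inj₁ x))

  a-U-side : ∀ i → toℕ i ≤ k → USide (region (label (aL i)))
  a-U-side i le = SA.place-low (λ v → USide (region v)) (λ _ → tt) i (s≤s le)

  b-U-side : ∀ j → toℕ j ≤ l → USide (region (label (bL j)))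
  b-U-side j le = SB.place-low (λ v → USide (region v)) (λ _ → tt) j (s≤s le)

  a-not-below : ∀ {r x} i → r ≢ a₁ → r ≢ a₂ → r ≢ u → r ≢ w → region x ≡ r → ¬ label (aL i) ≼ x
  a-not-below i r≢a₁ r≢a₂ r≢u r≢w =
    ¬≼-clade r≢u r≢w ([ (λ e r≡ → r≢a₁ (trans r≡ e)) , (λ e r≡ → r≢a₂ (trans r≡ e)) ]′ (a-region i))

  b-not-below : ∀ {r x} j → r ≢ b₁ → r ≢ b₂ → r ≢ u → r ≢ w → region x ≡ r → ¬ label (bL j) ≼ x
  b-not-below j r≢b₁ r≢b₂ r≢u r≢w =
    ¬≼-clade r≢u r≢w ([ (λ e r≡ → r≢b₁ (trans r≡ e)) , (λ e r≡ → r≢b₂ (trans r≡ e)) ]′ (b-region j))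

  below-W : ∀ {m} (f : Caterpillar m → V) → parent (f cat-top) ≡ just W → ∀ {y} → y ≼ f cat-top → y ≼ W
  below-W f top-parent y≼top = descendant-trans y≼top (up top-parent self)

  compatible-without-mid : ∀ i₀ i₀′ j₀ j₀′ → toℕ i₀ ≡ k → toℕ i₀′ ≡ suc k → toℕ j₀ ≡ l → toℕ j₀′ ≡ suc l →
    Compatible (λ q′ → Q s t q′ × ¬ SameQuartet q′ (aL i₀ ∙ aL i₀′ ∣ bL j₀ ∙ bL j₀′))
  compatible-without-mid i₀ i₀′ j₀ j₀′ e₀ e₀′ f₀ f₀′ = tree , displays-rest
    where
    displays-rest : ∀ q → Q s t q × ¬ SameQuartet q (aL i₀ ∙ aL i₀′ ∣ bL j₀ ∙ bL j₀′) → Displays tree q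
    displays-rest q (ends i₁ iₛ j₁ jₜ e₁ eₛ f₁ fₜ , _) =
      separated⇒displayed q (inj₂
        ( ¬≼-W (a-U-side i₁ (subst (_≤ k) (sym e₁) z≤n))
        , ¬≼-W (b-U-side j₁ (subst (_≤ l) (sym f₁) z≤n))
        , below-W A₂ EA₂.top-parent (a-below-A₂ iₛ (subst (k <_) (sym eₛ) (m<m+n k z<s)))
        , below-W B₂ EB₂.top-parent (b-below-B₂ jₜ (subst (l <_) (sym fₜ) (m<m+n l z<s)))))
    displays-rest q (mid i i′ j j′ e f , ≠q) with <-cmp (toℕ i) k
    ... | tri< i<k _ _ = separated⇒displayed q (inj₁
      ( a-below-A₁ i (<⇒≤ i<k) , a-below-A₁ i′ (subst (_≤ k) (sym e) i<k)
      , b-not-below j (λ ()) (λ ()) (λ ()) (λ ()) refl , b-not-below j′ (λ ()) (λ ()) (λ ()) (λ ()) refl))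
    ... | tri> _ _ k<i = separated⇒displayed q (inj₁
      ( a-below-A₂ i k<i , a-below-A₂ i′ (subst (k <_) (sym e) (m<n⇒m<1+n k<i))
      , b-not-below j (λ ()) (λ ()) (λ ()) (λ ()) refl , b-not-below j′ (λ ()) (λ ()) (λ ()) (λ ()) refl))
    ... | tri≈ _ i≡k _ with <-cmp (toℕ j) l
    ...   | tri< j<l _ _ = separated⇒displayed q (inj₂
      ( a-not-below i (λ ()) (λ ()) (λ ()) (λ ()) refl , a-not-below i′ (λ ()) (λ ()) (λ ()) (λ ()) refl
      , b-below-B₁ j (<⇒≤ j<l) , b-below-B₁ j′ (subst (_≤ l) (sym f) j<l)))
    ...   | tri> _ _ l<j = separated⇒displayed q (inj₂
      ( a-not-below i (λ ()) (λ ()) (λ ()) (λ ()) refl , a-not-below i′ (λ ()) (λ ()) (λ ()) (λ ()) refl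
      , b-below-B₂ j l<j , b-below-B₂ j′ (subst (l <_) (sym f) (m<n⇒m<1+n l<j))))
    ...   | tri≈ _ j≡l _ = ⊥-elim (≠q (same-quartet
      (cong inj₁ (toℕ-injective (trans i≡k (sym e₀))))
      (cong inj₁ (toℕ-injective (trans e (trans (cong suc i≡k) (sym e₀′)))))
      (cong inj₂ (toℕ-injective (trans j≡l (sym f₀))))
      (cong inj₂ (toℕ-injective (trans f (trans (cong suc j≡l) (sym f₀′)))))))

split-length : ∀ {k s} → suc k < s → ∃ λ k′ → s ≡ suc k + suc k′
split-length {k} {s} lt = s ∸ suc (suc k) , sym (trans (cong suc (+-suc k _)) (m+[n∸m]≡n lt))

compatible-without-ends : ∀ {s t} → 2 ≤ s → 2 ≤ t → ∀ i₁ iₛ j₁ jₜ →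
  toℕ i₁ ≡ 0 → toℕ iₛ ≡ s ∸ 1 → toℕ j₁ ≡ 0 → toℕ jₜ ≡ t ∸ 1 →
  Compatible (λ q′ → Q s t q′ × ¬ SameQuartet q′ (aL i₁ ∙ bL j₁ ∣ aL iₛ ∙ bL jₜ))
compatible-without-ends (s≤s (s≤s _)) (s≤s (s≤s _)) = EndsTree.compatible-without-ends _ _

compatible-without-mid : ∀ s t (i i′ : Fin s) (j j′ : Fin t) k l →
  toℕ i ≡ k → toℕ i′ ≡ suc k → toℕ j ≡ l → toℕ j′ ≡ suc l →
  Compatible (λ q′ → Q s t q′ × ¬ SameQuartet q′ (aL i ∙ aL i′ ∣ bL j ∙ bL j′))
compatible-without-mid s t i i′ j j′ k l e e′ f f′
  with split-length (subst (_< s) e′ (toℕ<n i′)) | split-length (subst (_< t) f′ (toℕ<n j′))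
... | k′ , refl | l′ , refl = MidTree.compatible-without-mid k k′ l l′ i i′ j j′ e e′ f f′

lemma4 : (s t : ℕ) → 2 ≤ s → 2 ≤ t →
    (q : Quartet (L s t)) → Q s t q →
    Compatible (λ q' → Q s t q' × ¬ SameQuartet q' q)
lemma4 s t 2≤s 2≤t _ (ends i₁ iₛ j₁ jₜ e₁ eₛ f₁ fₜ) = compatible-without-ends 2≤s 2≤t i₁ iₛ j₁ jₜ e₁ eₛ f₁ fₜ
lemma4 s t _ _ _ (mid i i′ j j′ e f) = compatible-without-mid s t i i′ j j′ (toℕ i) (toℕ j) refl e refl f
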